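{- Let $n\ge1$, $d\in[n]$. For $M\in\mathcal{M}_{n,d}$ and $(j_1,j_2)\in[n]^2$ define the walk $w_{(j_1,j_2)}:[n]\to\mathbb{Z}$ by $$w_{(j_1,j_2)}(i)=\sum_{k=1}^i\Big(\mathbf{1}\big(M(k,j_1)=1,M(k,j_2)=0\big)-\mathbf{1}\big(M(k,j_1)=0,M(k,j_2)=1\big)\Big).$$ Call $(j_1,j_2)$ reflecting for $M$ if (1) $w_{(j_1,j_2)}(1)=+1$, (2) $w_{(j_1,j_2)}(2)\ne+1$, and (3) there exists $i\in\{3,\dots,n\}$ with $w_{(j_1,j_2)}(i)=+1$; in that case let $i^*=i^*(j_1,j_2)=\min\{i\in\{3,\dots,n\}:w_{(j_1,j_2)}(i)=+1\}$. Let $\Psi_{(j_1,j_2)}:\mathcal{M}_{n,d}\to\mathcal{M}_{n,d}$ be the map which, if $(j_1,j_2)$ is reflecting for $M$, replaces the submatrix of $M$ with rows $2,\dots,i^*$ and columns $(j_1,j_2)$ by the submatrix with rows $2,\dots,i^*$ and columns $(j_2,j_1)$ (i.e.\ swaps the entries of columns $j_1$ and $j_2$ in rows $2,\dots,i^*$), and leaves $M$ unchanged otherwise. If $M$ is a uniformly random element of $\mathcal{M}_{n,d}$ and $J_1,J_2\in[n]$ are random column indices independent of $M$, then with $\tilde M:=\Psi_{(J_1,J_2)}(M)$, the pair $(M,\tilde M)$ is an exchangeable pair of uniformly random elements of $\mathcal{M}_{n,d}$.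
   Context: $\mathcal{M}_{n,d}$ is the set of $n\times n$ matrices with entries in $\{0,1\}$ in which every row and every column contains exactly $d$ ones. A pair $(X,Y)$ of random variables is exchangeable if $(X,Y)\overset{d}{=}(Y,X)$.
   Formalization: The joint law of the random column indices $J_1,J_2$ takes only rational values, being given by natural-number weights on pairs of columns. -}

module Defs where

open import Data.Bool using (Bool; true; false; if_then_else_; _∧_; not)
open import Data.Nat using (ℕ; zero; suc; _+_; _*_; _∸_; _≤_; _<ᵇ_)
open import Data.Fin using (Fin; toℕ)
open import Data.Fin.Properties using () renaming (_≟_ to _≟ᶠ_)
open import Data.Integer using (ℤ; +_; -[1+_]) renaming (_+_ to _+ℤ_)
import Data.Integer.Properties as ℤP
open import Data.Nat.ListAction using (sum)
open import Data.List using (List; []; _∷_; map; concatMap; upTo; allFin; filter; take; foldr)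
open import Data.Vec using (Vec; []; _∷_; lookup; tabulate; toList; count)
open import Data.Vec.Properties using (≡-dec)
open import Data.Maybe using (Maybe; just; nothing)
open import Relation.Nullary using (Dec; yes; no; does)
open import Relation.Binary.PropositionalEquality using (_≡_)
open import Data.Bool.Properties using () renaming (_≟_ to _≟ᵇ_)

-- An n×n 0/1 matrix: a vector of n rows, each a vector of n booleans (true = 1).
Mat : ℕ → Set
Mat n = Vec (Vec Bool n) n

_≟M_ : ∀ {n} (A B : Mat n) → Dec (A ≡ B)
_≟M_ = ≡-dec (≡-dec _≟ᵇ_)

rowSum : ∀ {n} → Mat n → Fin n → ℕ
rowSum M i = count (λ b → b ≟ᵇ true) (lookup M i)

colSum : ∀ {n} → Mat n → Fin n → ℕ
colSum {n} M j = count (λ b → b ≟ᵇ true) (tabulate {n = n} (λ i → lookup (lookup M i) j))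

allTrue : List Bool → Bool
allTrue = foldr _∧_ true

inMnd : ∀ {n} → ℕ → Mat n → Bool
inMnd {n} d M =
  allTrue (map (λ i → does (rowSum M i Data.Nat.≟ d)) (allFin n)) ∧
  allTrue (map (λ j → does (colSum M j Data.Nat.≟ d)) (allFin n))

vecsOver : ∀ {A : Set} → List A → (m : ℕ) → List (Vec A m)
vecsOver xs zero = [] ∷ []
vecsOver xs (suc m) = concatMap (λ x → map (x ∷_) (vecsOver xs m)) xs

allMats : (n : ℕ) → List (Mat n)
allMats n = vecsOver (vecsOver (false ∷ true ∷ []) n) n

step : ∀ {n} → Fin n → Fin n → Vec Bool n → ℤ
step j1 j2 row with lookup row j1 | lookup row j2
... | true  | false = + 1
... | false | true  = -[1+ 0 ]
... | _     | _     = + 0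

sumℤ : List ℤ → ℤ
sumℤ = foldr _+ℤ_ (+ 0)

-- w_{(j1,j2)}(i) = Σ_{k=1}^{i} step(row k)   (rows 1-indexed; row k is index k-1)
walk : ∀ {n} → Mat n → Fin n → Fin n → ℕ → ℤ
walk M j1 j2 i = sumℤ (map (step j1 j2) (take i (toList M)))

isPlusOne : ℤ → Bool
isPlusOne z = does (z ℤP.≟ + 1)

firstHit : (ℕ → Bool) → List ℕ → Maybe ℕ
firstHit p [] = nothing
firstHit p (i ∷ is) = if p i then just i else firstHit p is

from3to : ℕ → List ℕ
from3to n = map (λ k → 3 + k) (upTo (n ∸ 2))

reflectTime : ∀ {n} → Mat n → Fin n → Fin n → Maybe ℕ
reflectTime {n} M j1 j2 =
  if isPlusOne (walk M j1 j2 1) ∧ not (isPlusOne (walk M j1 j2 2))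
  then firstHit (λ i → isPlusOne (walk M j1 j2 i)) (from3to n)
  else nothing

swapRow : ∀ {n} → Fin n → Fin n → Vec Bool n → Vec Bool n
swapRow j1 j2 row = tabulate λ c →
  if does (c ≟ᶠ j1) then lookup row j2
  else if does (c ≟ᶠ j2) then lookup row j1
  else lookup row c

-- Ψ_{(j1,j2)}: swap columns j1,j2 in rows 2..i* (0-based row indices k with 1 ≤ k < i*)
Ψ : ∀ {n} → Fin n → Fin n → Mat n → Mat n
Ψ {n} j1 j2 M with reflectTime M j1 j2
... | nothing = M
... | just istar = tabulate λ k →
        if (0 <ᵇ toℕ k) ∧ (toℕ k <ᵇ istar)
        then swapRow j1 j2 (lookup M k)
        else lookup M k

indicator : Bool → ℕ
indicator true = 1
indicator false = 0

-- Unnormalised joint law of (M, M̃) where M is uniform on 𝓜_{n,d} and (J1,J2) is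
-- independent of M with law proportional to the weights p:
--   P(M = A, M̃ = B) · |𝓜_{n,d}| · Σ p  =  [A ∈ 𝓜_{n,d}] · Σ_{j1,j2} p(j1,j2) · [Ψ_{(j1,j2)}(A) = B]
jointMass : ∀ {n} → ℕ → (Fin n → Fin n → ℕ) → Mat n → Mat n → ℕ
jointMass {n} d p A B =
  indicator (inMnd d A) *
  sum (map (λ j1 → sum (map (λ j2 → p j1 j2 * indicator (does (Ψ j1 j2 A ≟M B))) (allFin n))) (allFin n))

totalWeight : ∀ {n} → (Fin n → Fin n → ℕ) → ℕ
totalWeight {n} p = sum (map (λ j1 → sum (map (λ j2 → p j1 j2) (allFin n))) (allFin n))

-- If (j₁,j₂) is reflecting for M, write w(i) = 1 + v(i); swapping columns j₁ and j₂
-- in rows 2,…,i* negates the steps of v there, so v becomes −v up to i* and, as v(i*) = 0, is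
-- unchanged afterwards. Since 1 + v = 1 iff 1 − v = 1, the times at which w = +1, hence the
-- reflecting property and i*, are the same for Ψ M, and so Ψ (Ψ M) = M. Each row of Ψ M is a
-- permutation of the row of M, and v(i*) = 0 says that rows 2,…,i* carry as many ones in column j₁
-- as in column j₂, so Ψ preserves 𝓜_{n,d}. Hence the joint mass is symmetric term by term in
-- (j₁,j₂), and by symmetry summing it over A reduces to counting the one A with A = Ψ B.
module Submission where

open import Defs
open import Data.Bool using (Bool; true; false; if_then_else_; _∧_)
open import Data.Bool.Properties using () renaming (_≟_ to _≟ᵇ_)
open import Data.Fin as Fin using (Fin; toℕ)
open import Data.Fin.Properties using () renaming (_≟_ to _≟ᶠ_)
import Data.Fin.Permutation as Permutation
import Data.Fin.Permutation.Components as Transposition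
open import Data.Integer using (ℤ; +_; -[1+_]; -_) renaming (_+_ to _+ℤ_)
import Data.Integer.Properties as ℤ
open import Data.Integer.Solver using (module +-*-Solver)
open import Data.List using (List; []; _∷_; map; take; drop; _++_; concatMap; allFin)
import Data.List.Properties as List
open import Data.Maybe using (just; nothing)
open import Data.Maybe.Properties using (just-injective)
open import Data.Nat using (ℕ; zero; suc; _+_; _*_; _≤_; _<ᵇ_; z≤n; s≤s)
import Data.Nat.Properties as ℕ
open import Data.Nat.ListAction using (sum)
open import Data.Nat.ListAction.Properties using (sum-++)
open import Data.Product using (∃-syntax; _×_; _,_; proj₂)
open import Data.Sum using (_⊎_; inj₁; inj₂)
open import Data.Vec using (Vec; []; _∷_; lookup; tabulate; toList; count)
import Data.Vec.Properties as Vec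
open import Function using (_∘_)
open import Relation.Binary.Definitions using (DecidableEquality)
open import Relation.Binary.PropositionalEquality
open import Relation.Nullary using (yes; no; does)
open import Relation.Nullary.Decidable using (dec-true; dec-false)
open import Algebra.Properties.CommutativeSemigroup ℕ.*-commutativeSemigroup using () renaming (x∙yz≈y∙xz to *-left-comm)
open import Algebra.Properties.CommutativeSemigroup ℕ.+-commutativeSemigroup using () renaming (interchange to +-interchange)
open import Algebra.Properties.CommutativeSemigroup ℤ.+-commutativeSemigroup using () renaming (interchange to +ℤ-interchange)
open import Algebra.Properties.AbelianGroup ℤ.+-0-abelianGroup using (∙-cancelˡ)
import Algebra.Properties.CommutativeMonoid.Sum ℕ.+-0-commutativeMonoid as FinSum

private
  variable
    A B : Set


sum-map-*ˡ : ∀ a (f : A → ℕ) xs → a * sum (map f xs) ≡ sum (map (λ x → a * f x) xs)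
sum-map-*ˡ a f [] = ℕ.*-zeroʳ a
sum-map-*ˡ a f (x ∷ xs) = trans (ℕ.*-distribˡ-+ a (f x) _) (cong (_+_ (a * f x)) (sum-map-*ˡ a f xs))

sum-map-cong : {f g : A → ℕ} → (∀ x → f x ≡ g x) → ∀ xs → sum (map f xs) ≡ sum (map g xs)
sum-map-cong f≗g xs = cong sum (List.map-cong f≗g xs)

sum-map-+ : ∀ (f g : A → ℕ) xs → sum (map (λ x → f x + g x) xs) ≡ sum (map f xs) + sum (map g xs)
sum-map-+ f g [] = refl
sum-map-+ f g (x ∷ xs) =
  trans (cong (_+_ (f x + g x)) (sum-map-+ f g xs)) (+-interchange (f x) (g x) _ _)

sum-map-exchange : ∀ (g : A → B → ℕ) xs ys →
  sum (map (λ x → sum (map (g x) ys)) xs) ≡ sum (map (λ y → sum (map (λ x → g x y) xs)) ys)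
sum-map-exchange g [] ys = sym (sum-map-zero ys)
  where
  sum-map-zero : ∀ (ys : List B) → sum (map (λ _ → 0) ys) ≡ 0
  sum-map-zero [] = refl
  sum-map-zero (_ ∷ ys) = sum-map-zero ys
sum-map-exchange g (x ∷ xs) ys = trans (cong (_+_ (sum (map (g x) ys))) (sum-map-exchange g xs ys))
  (sym (sum-map-+ (g x) (λ y → sum (map (λ x → g x y) xs)) ys))

sum-map-concatMap : ∀ (g : B → ℕ) (h : A → List B) xs →
  sum (map g (concatMap h xs)) ≡ sum (map (λ x → sum (map g (h x))) xs)
sum-map-concatMap g h [] = refl
sum-map-concatMap g h (x ∷ xs) = begin
  sum (map g (h x ++ concatMap h xs))            ≡⟨ cong sum (List.map-++ g (h x) _) ⟩
  sum (map g (h x) ++ map g (concatMap h xs))    ≡⟨ sum-++ (map g (h x)) _ ⟩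
  sum (map g (h x)) + sum (map g (concatMap h xs)) ≡⟨ cong (_+_ (sum (map g (h x)))) (sum-map-concatMap g h xs) ⟩
  sum (map g (h x)) + sum (map (λ x → sum (map g (h x))) xs) ∎
  where open ≡-Reasoning

indicator-∧ : ∀ a b → indicator (a ∧ b) ≡ indicator a * indicator b
indicator-∧ false b = refl
indicator-∧ true false = refl
indicator-∧ true true = refl

lookup-extensional : ∀ {k} {u v : Vec A k} → (∀ i → lookup u i ≡ lookup v i) → u ≡ v
lookup-extensional {u = u} {v} u≗v =
  trans (sym (Vec.tabulate∘lookup u)) (trans (Vec.tabulate-cong u≗v) (Vec.tabulate∘lookup v))

count-tabulate : ∀ {k} (f : Fin k → Bool) → count (_≟ᵇ true) (tabulate f) ≡ FinSum.sum (indicator ∘ f)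
count-tabulate {zero} f = refl
count-tabulate {suc k} f with f Fin.zero
... | true  = cong suc (count-tabulate (f ∘ Fin.suc))
... | false = count-tabulate (f ∘ Fin.suc)

multiplicity : DecidableEquality A → A → List A → ℕ
multiplicity _≟_ a xs = sum (map (λ x → indicator (does (a ≟ x))) xs)

vecsOver-multiplicity : (_≟_ : DecidableEquality A) (xs : List A) →
  (∀ a → multiplicity _≟_ a xs ≡ 1) →
  ∀ m (u : Vec A m) → multiplicity (Vec.≡-dec _≟_) u (vecsOver xs m) ≡ 1
vecsOver-multiplicity _≟_ xs once zero [] = refl
vecsOver-multiplicity _≟_ xs once (suc m) (a ∷ u) = begin
  sum (map [ a ∷ u ≟_] (concatMap (λ x → map (x ∷_) (vecsOver xs m)) xs))
    ≡⟨ sum-map-concatMap [ a ∷ u ≟_] (λ x → map (x ∷_) (vecsOver xs m)) xs ⟩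
  sum (map (λ x → sum (map [ a ∷ u ≟_] (map (x ∷_) (vecsOver xs m)))) xs)
    ≡⟨ sum-map-cong (λ x → cong sum (sym (List.map-∘ (vecsOver xs m)))) xs ⟩
  sum (map (λ x → sum (map (λ v → indicator (does (a ≟ x) ∧ does (u ≟ⱽ v))) (vecsOver xs m))) xs)
    ≡⟨ sum-map-cong (λ x → sum-map-cong (λ v → indicator-∧ (does (a ≟ x)) _) (vecsOver xs m)) xs ⟩
  sum (map (λ x → sum (map (λ v → indicator (does (a ≟ x)) * [ u ≟_] v) (vecsOver xs m))) xs)
    ≡⟨ sum-map-cong (λ x → sym (sum-map-*ˡ (indicator (does (a ≟ x))) [ u ≟_] (vecsOver xs m))) xs ⟩
  sum (map (λ x → indicator (does (a ≟ x)) * multiplicity _≟ⱽ_ u (vecsOver xs m)) xs)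
    ≡⟨ sum-map-cong (λ x → cong (_*_ (indicator (does (a ≟ x)))) (vecsOver-multiplicity _≟_ xs once m u)) xs ⟩
  sum (map (λ x → indicator (does (a ≟ x)) * 1) xs)
    ≡⟨ sum-map-cong (λ x → ℕ.*-identityʳ _) xs ⟩
  multiplicity _≟_ a xs
    ≡⟨ once a ⟩
  1 ∎
  where
  open ≡-Reasoning
  _≟ⱽ_ : DecidableEquality (Vec _ m)
  _≟ⱽ_ = Vec.≡-dec _≟_
  [_≟_] : ∀ {k} → Vec _ k → Vec _ k → ℕ
  [ v ≟ w ] = indicator (does (Vec.≡-dec _≟_ v w))

allMats-multiplicity : ∀ n (C : Mat n) → multiplicity _≟M_ C (allMats n) ≡ 1
allMats-multiplicity n = vecsOver-multiplicity _ _ (vecsOver-multiplicity _≟ᵇ_ _ bits n) n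
  where
  bits : ∀ b → multiplicity _≟ᵇ_ b (false ∷ true ∷ []) ≡ 1
  bits false = refl
  bits true = refl

mapPrefix : (A → A) → ℕ → List A → List A
mapPrefix f J xs = map f (take J xs) ++ drop J xs

map-mapPrefix : ∀ (h : A → B) {f : A → A} {g : B → B} → (∀ x → h (f x) ≡ g (h x)) →
  ∀ J xs → map h (mapPrefix f J xs) ≡ mapPrefix g J (map h xs)
map-mapPrefix h h∘f≗g∘h zero xs = refl
map-mapPrefix h h∘f≗g∘h (suc J) [] = refl
map-mapPrefix h h∘f≗g∘h (suc J) (x ∷ xs) = cong₂ _∷_ (h∘f≗g∘h x) (map-mapPrefix h h∘f≗g∘h J xs)

sum-map-mapPrefix : ∀ (h : A → ℕ) (f : A → A) J xs →
  sum (map (h ∘ f) (take J xs)) ≡ sum (map h (take J xs)) →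
  sum (map h (mapPrefix f J xs)) ≡ sum (map h xs)
sum-map-mapPrefix h f J xs prefix = begin
  sum (map h (map f (take J xs) ++ drop J xs))
    ≡⟨ cong sum (List.map-++ h (map f (take J xs)) _) ⟩
  sum (map h (map f (take J xs)) ++ map h (drop J xs))
    ≡⟨ sum-++ (map h (map f (take J xs))) _ ⟩
  sum (map h (map f (take J xs))) + sum (map h (drop J xs))
    ≡⟨ cong (_+ sum (map h (drop J xs))) (trans (cong sum (sym (List.map-∘ (take J xs)))) prefix) ⟩
  sum (map h (take J xs)) + sum (map h (drop J xs))
    ≡⟨ sum-++ (map h (take J xs)) _ ⟨
  sum (map h (take J xs) ++ map h (drop J xs))
    ≡⟨ cong sum (List.map-++ h (take J xs) _) ⟨
  sum (map h (take J xs ++ drop J xs))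
    ≡⟨ cong (sum ∘ map h) (List.take++drop≡id J xs) ⟩
  sum (map h xs) ∎
  where open ≡-Reasoning

toList-tabulate-prefix : ∀ {k} (f : A → A) J (V : Vec A k) →
  toList (tabulate λ i → if toℕ i <ᵇ J then f (lookup V i) else lookup V i) ≡ mapPrefix f J (toList V)
toList-tabulate-prefix f zero V = cong toList (Vec.tabulate∘lookup V)
toList-tabulate-prefix f (suc J) [] = refl
toList-tabulate-prefix f (suc J) (x ∷ V) = cong (f x ∷_) (toList-tabulate-prefix f J V)

toList-tabulate-segment : ∀ {k} (f : A → A) J (V : Vec A k) {x xs} → toList V ≡ x ∷ xs →
  toList (tabulate λ i → if (0 <ᵇ toℕ i) ∧ (toℕ i <ᵇ suc J) then f (lookup V i) else lookup V i)
    ≡ x ∷ mapPrefix f J xs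
toList-tabulate-segment f J (x ∷ V) refl = cong (x ∷_) (toList-tabulate-prefix f J V)

partialSum : List ℤ → ℕ → ℤ
partialSum zs i = sumℤ (take i zs)

partialSum-negatePrefix-≤ : ∀ J zs {i} → i ≤ J → partialSum (mapPrefix -_ J zs) i ≡ - partialSum zs i
partialSum-negatePrefix-≤ J zs z≤n = refl
partialSum-negatePrefix-≤ (suc J) [] (s≤s i≤J) = refl
partialSum-negatePrefix-≤ (suc J) (z ∷ zs) {suc i} (s≤s i≤J) =
  trans (cong (- z +ℤ_) (partialSum-negatePrefix-≤ J zs i≤J)) (sym (ℤ.neg-distrib-+ z _))

partialSum-negatePrefix-≥ : ∀ J zs {i} → J ≤ i →
  partialSum (mapPrefix -_ J zs) i ≡ partialSum zs i +ℤ - partialSum zs J +ℤ - partialSum zs J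
partialSum-negatePrefix-≥ zero zs z≤n = sym (trans (ℤ.+-identityʳ _) (ℤ.+-identityʳ _))
partialSum-negatePrefix-≥ (suc J) [] (s≤s J≤i) = refl
partialSum-negatePrefix-≥ (suc J) (z ∷ zs) {suc i} (s≤s J≤i)
  rewrite partialSum-negatePrefix-≥ J zs J≤i =
  solve 3 (λ z s t → :- z :+ (s :+ :- t :+ :- t) := (z :+ s) :+ :- (z :+ t) :+ :- (z :+ t))
    refl z (partialSum zs i) (partialSum zs J)
  where open +-*-Solver

partialSum-negateBalancedPrefix : ∀ J zs → partialSum zs J ≡ + 0 → ∀ i →
  partialSum (mapPrefix -_ J zs) i ≡ - partialSum zs i ⊎ partialSum (mapPrefix -_ J zs) i ≡ partialSum zs i
partialSum-negateBalancedPrefix J zs balanced i with ℕ.≤-total i J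
... | inj₁ i≤J = inj₁ (partialSum-negatePrefix-≤ J zs i≤J)
... | inj₂ J≤i = inj₂ (begin
  partialSum (mapPrefix -_ J zs) i
    ≡⟨ partialSum-negatePrefix-≥ J zs J≤i ⟩
  partialSum zs i +ℤ - partialSum zs J +ℤ - partialSum zs J
    ≡⟨ cong (λ t → partialSum zs i +ℤ - t +ℤ - t) balanced ⟩
  partialSum zs i +ℤ + 0 +ℤ + 0
    ≡⟨ trans (ℤ.+-identityʳ _) (ℤ.+-identityʳ _) ⟩
  partialSum zs i ∎)
  where open ≡-Reasoning

isPlusOne-1+-± : ∀ {x y} → y ≡ - x ⊎ y ≡ x → isPlusOne (+ 1 +ℤ y) ≡ isPlusOne (+ 1 +ℤ x)
isPlusOne-1+-± (inj₂ refl) = refl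
isPlusOne-1+-± {+ zero} (inj₁ refl) = refl
isPlusOne-1+-± {+ suc zero} (inj₁ refl) = refl
isPlusOne-1+-± {+ suc (suc k)} (inj₁ refl) = refl
isPlusOne-1+-± { -[1+ zero ]} (inj₁ refl) = refl
isPlusOne-1+-± { -[1+ suc k ]} (inj₁ refl) = refl

inMnd-cong : ∀ {n} d {A B : Mat n} → (∀ i → rowSum A i ≡ rowSum B i) → (∀ j → colSum A j ≡ colSum B j) →
  inMnd d A ≡ inMnd d B
inMnd-cong {n} d rows cols = cong₂ _∧_
  (cong allTrue (List.map-cong (λ i → cong (λ s → does (s ℕ.≟ d)) (rows i)) (allFin n)))
  (cong allTrue (List.map-cong (λ j → cong (λ s → does (s ℕ.≟ d)) (cols j)) (allFin n)))

firstHit-sound : ∀ p xs {x} → firstHit p xs ≡ just x → p x ≡ true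
firstHit-sound p (i ∷ is) eq with p i in hit
... | true  = subst (λ x → p x ≡ true) (just-injective eq) hit
... | false = firstHit-sound p is eq

firstHit-cong : ∀ {p q} → (∀ i → p i ≡ q i) → ∀ xs → firstHit p xs ≡ firstHit q xs
firstHit-cong p≗q [] = refl
firstHit-cong p≗q (i ∷ is) rewrite p≗q i | firstHit-cong p≗q is = refl

isPlusOne-sound : ∀ {z} → isPlusOne z ≡ true → z ≡ + 1
isPlusOne-sound {z} hit with z ℤ.≟ + 1
... | yes z≡1 = z≡1

module _ {n : ℕ} {j₁ j₂ : Fin n} where

  reflectTime-cong : ∀ {M M' : Mat n} → (∀ i → isPlusOne (walk M' j₁ j₂ i) ≡ isPlusOne (walk M j₁ j₂ i)) →
    reflectTime M' j₁ j₂ ≡ reflectTime M j₁ j₂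
  reflectTime-cong same rewrite same 1 | same 2 | firstHit-cong same (from3to n) = refl

  reflectTime-just : ∀ {M i*} → reflectTime M j₁ j₂ ≡ just i* →
    walk M j₁ j₂ 1 ≡ + 1 × walk M j₁ j₂ i* ≡ + 1
  reflectTime-just {M = M} eq with isPlusOne (walk M j₁ j₂ 1) in up | isPlusOne (walk M j₁ j₂ 2)
  ... | true | false = isPlusOne-sound up , isPlusOne-sound (firstHit-sound _ (from3to n) eq)

module _ {n : ℕ} (j₁ j₂ : Fin n) where

  private
    swap : Vec Bool n → Vec Bool n
    swap = swapRow j₁ j₂

    lookup-swapRow : ∀ r c → lookup (swap r) c ≡
      (if does (c ≟ᶠ j₁) then lookup r j₂ else if does (c ≟ᶠ j₂) then lookup r j₁ else lookup r c)
    lookup-swapRow r c = Vec.lookup∘tabulate _ c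

  lookup-swapRow-j₁ : ∀ r → lookup (swapRow j₁ j₂ r) j₁ ≡ lookup r j₂
  lookup-swapRow-j₁ r rewrite lookup-swapRow r j₁ | dec-true (j₁ ≟ᶠ j₁) refl = refl

  lookup-swapRow-j₂ : ∀ r → lookup (swapRow j₁ j₂ r) j₂ ≡ lookup r j₁
  lookup-swapRow-j₂ r rewrite lookup-swapRow r j₂ with j₂ ≟ᶠ j₁
  ... | yes j₂≡j₁ = cong (lookup r) j₂≡j₁
  ... | no _ rewrite dec-true (j₂ ≟ᶠ j₂) refl = refl

  lookup-swapRow-other : ∀ r {c} → c ≢ j₁ → c ≢ j₂ → lookup (swapRow j₁ j₂ r) c ≡ lookup r c
  lookup-swapRow-other r {c} c≢j₁ c≢j₂
    rewrite lookup-swapRow r c | dec-false (c ≟ᶠ j₁) c≢j₁ | dec-false (c ≟ᶠ j₂) c≢j₂ = refl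

  lookup-swapRow-transpose : ∀ r c → lookup (swapRow j₁ j₂ r) c ≡ lookup r (Transposition.transpose j₁ j₂ c)
  lookup-swapRow-transpose r c rewrite lookup-swapRow r c with c ≟ᶠ j₁
  ... | yes _ = refl
  ... | no _ with c ≟ᶠ j₂
  ...   | yes _ = refl
  ...   | no _ = refl

  swapRow-involutive : ∀ r → swapRow j₁ j₂ (swapRow j₁ j₂ r) ≡ r
  swapRow-involutive r = lookup-extensional twice
    where
    twice : ∀ c → lookup (swap (swap r)) c ≡ lookup r c
    twice c with c ≟ᶠ j₁ | c ≟ᶠ j₂
    ... | yes refl | _ = trans (lookup-swapRow-j₁ (swap r)) (lookup-swapRow-j₂ r)
    ... | no _ | yes refl = trans (lookup-swapRow-j₂ (swap r)) (lookup-swapRow-j₁ r)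
    ... | no c≢j₁ | no c≢j₂ =
      trans (lookup-swapRow-other (swap r) c≢j₁ c≢j₂) (lookup-swapRow-other r c≢j₁ c≢j₂)

  count-swapRow : ∀ r → count (_≟ᵇ true) (swapRow j₁ j₂ r) ≡ count (_≟ᵇ true) r
  count-swapRow r = begin
    count (_≟ᵇ true) (swap r)
      ≡⟨ cong (count (_≟ᵇ true)) (sym (Vec.tabulate∘lookup (swap r))) ⟩
    count (_≟ᵇ true) (tabulate (lookup (swap r)))
      ≡⟨ count-tabulate (lookup (swap r)) ⟩
    FinSum.sum (indicator ∘ lookup (swap r))
      ≡⟨ FinSum.sum-cong-≗ (cong indicator ∘ lookup-swapRow-transpose r) ⟩
    FinSum.sum (indicator ∘ lookup r ∘ Transposition.transpose j₁ j₂)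
      ≡⟨ FinSum.sum-permute (indicator ∘ lookup r) (Permutation.transpose j₁ j₂) ⟨
    FinSum.sum (indicator ∘ lookup r)
      ≡⟨ count-tabulate (lookup r) ⟨
    count (_≟ᵇ true) (tabulate (lookup r))
      ≡⟨ cong (count (_≟ᵇ true)) (Vec.tabulate∘lookup r) ⟩
    count (_≟ᵇ true) r ∎
    where open ≡-Reasoning

  step-swapRow : ∀ r → step j₁ j₂ (swapRow j₁ j₂ r) ≡ - step j₁ j₂ r
  step-swapRow r rewrite lookup-swapRow-j₁ r | lookup-swapRow-j₂ r with lookup r j₁ | lookup r j₂
  ... | true  | true  = refl
  ... | true  | false = refl
  ... | false | true  = refl
  ... | false | false = refl

  indicator-step : ∀ r → + indicator (lookup r j₁) ≡ + indicator (lookup r j₂) +ℤ step j₁ j₂ r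
  indicator-step r with lookup r j₁ | lookup r j₂
  ... | true  | true  = refl
  ... | true  | false = refl
  ... | false | true  = refl
  ... | false | false = refl

  inSegment : ℕ → Fin n → Bool
  inSegment i* k = (0 <ᵇ toℕ k) ∧ (toℕ k <ᵇ i*)

  swapRows : ℕ → Mat n → Mat n
  swapRows i* M = tabulate λ k → if inSegment i* k then swapRow j₁ j₂ (lookup M k) else lookup M k

  Ψ-nothing : ∀ {M} → reflectTime M j₁ j₂ ≡ nothing → Ψ j₁ j₂ M ≡ M
  Ψ-nothing eq rewrite eq = refl

  Ψ-just : ∀ {M i*} → reflectTime M j₁ j₂ ≡ just i* → Ψ j₁ j₂ M ≡ swapRows i* M
  Ψ-just eq rewrite eq = refl

  swapRows-involutive : ∀ i* M → swapRows i* (swapRows i* M) ≡ M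
  swapRows-involutive i* M = lookup-extensional λ k →
    trans (Vec.lookup∘tabulate _ k) (undo (inSegment i* k) (Vec.lookup∘tabulate _ k))
    where
    undo : ∀ {r s} b → s ≡ (if b then swap r else r) → (if b then swap s else s) ≡ r
    undo true refl = swapRow-involutive _
    undo false refl = refl

  rowSum-swapRows : ∀ i* M i → rowSum (swapRows i* M) i ≡ rowSum M i
  rowSum-swapRows i* M i = trans (cong (count (_≟ᵇ true)) (Vec.lookup∘tabulate _ i)) (swapped (inSegment i* i))
    where
    swapped : ∀ b → count (_≟ᵇ true) (if b then swap (lookup M i) else lookup M i) ≡ rowSum M i
    swapped true = count-swapRow (lookup M i)
    swapped false = refl

  walkFrom : List (Vec Bool n) → ℕ → ℤ
  walkFrom rs i = sumℤ (map (step j₁ j₂) (take i rs))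

  walkFrom-partialSum : ∀ rs i → walkFrom rs i ≡ partialSum (map (step j₁ j₂) rs) i
  walkFrom-partialSum rs i = cong sumℤ (sym (List.take-map i rs))

  entry : Fin n → Vec Bool n → ℕ
  entry j r = indicator (lookup r j)

  columnCount : Fin n → List (Vec Bool n) → ℕ
  columnCount j rs = sum (map (entry j) rs)

  colSum-toList : ∀ M j → colSum M j ≡ columnCount j (toList M)
  colSum-toList M j = go M
    where
    go : ∀ {k} (V : Vec (Vec Bool n) k) →
      count (_≟ᵇ true) (tabulate {n = k} (λ i → lookup (lookup V i) j)) ≡ columnCount j (toList V)
    go [] = refl
    go (r ∷ V) with lookup r j
    ... | true  = cong suc (go V)
    ... | false = go V

  columnCount-difference : ∀ rs →
    + columnCount j₁ rs ≡ + columnCount j₂ rs +ℤ sumℤ (map (step j₁ j₂) rs)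
  columnCount-difference [] = refl
  columnCount-difference (r ∷ rs) = begin
    + (indicator (lookup r j₁) + columnCount j₁ rs)
      ≡⟨ ℤ.pos-+ (indicator (lookup r j₁)) _ ⟩
    + indicator (lookup r j₁) +ℤ + columnCount j₁ rs
      ≡⟨ cong₂ _+ℤ_ (indicator-step r) (columnCount-difference rs) ⟩
    (+ indicator (lookup r j₂) +ℤ step j₁ j₂ r) +ℤ (+ columnCount j₂ rs +ℤ sumℤ (map (step j₁ j₂) rs))
      ≡⟨ +ℤ-interchange (+ indicator (lookup r j₂)) (step j₁ j₂ r) (+ columnCount j₂ rs) _ ⟩
    (+ indicator (lookup r j₂) +ℤ + columnCount j₂ rs) +ℤ (step j₁ j₂ r +ℤ sumℤ (map (step j₁ j₂) rs))
      ≡⟨ cong (_+ℤ sumℤ (map (step j₁ j₂) (r ∷ rs))) (ℤ.pos-+ (indicator (lookup r j₂)) _) ⟨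
    + (indicator (lookup r j₂) + columnCount j₂ rs) +ℤ sumℤ (map (step j₁ j₂) (r ∷ rs)) ∎
    where open ≡-Reasoning

  balanced-columnCount : ∀ rs → sumℤ (map (step j₁ j₂) rs) ≡ + 0 → columnCount j₁ rs ≡ columnCount j₂ rs
  balanced-columnCount rs balanced = ℤ.+-injective (begin
    + columnCount j₁ rs                                   ≡⟨ columnCount-difference rs ⟩
    + columnCount j₂ rs +ℤ sumℤ (map (step j₁ j₂) rs)     ≡⟨ cong (+ columnCount j₂ rs +ℤ_) balanced ⟩
    + columnCount j₂ rs +ℤ + 0                            ≡⟨ ℤ.+-identityʳ _ ⟩
    + columnCount j₂ rs                                   ∎)
    where open ≡-Reasoning

  columnCount-mapPrefix-swapRow : ∀ J rs → walkFrom rs J ≡ + 0 →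
    ∀ j → columnCount j (mapPrefix swap J rs) ≡ columnCount j rs
  columnCount-mapPrefix-swapRow J rs balanced j = sum-map-mapPrefix (entry j) swap J rs (prefix j)
    where
    prefix : ∀ j → sum (map (entry j ∘ swap) (take J rs)) ≡ columnCount j (take J rs)
    prefix j with j ≟ᶠ j₁ | j ≟ᶠ j₂
    ... | yes refl | _ = trans (sum-map-cong (cong indicator ∘ lookup-swapRow-j₁) (take J rs))
                          (sym (balanced-columnCount (take J rs) balanced))
    ... | no _ | yes refl = trans (sum-map-cong (cong indicator ∘ lookup-swapRow-j₂) (take J rs))
                          (balanced-columnCount (take J rs) balanced)
    ... | no j≢j₁ | no j≢j₂ =
      sum-map-cong (λ r → cong indicator (lookup-swapRow-other r j≢j₁ j≢j₂)) (take J rs)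

  walkFrom-mapPrefix-swapRow : ∀ {r} J rs → step j₁ j₂ r ≡ + 1 → walkFrom rs J ≡ + 0 →
    ∀ i → isPlusOne (walkFrom (r ∷ mapPrefix swap J rs) i) ≡ isPlusOne (walkFrom (r ∷ rs) i)
  walkFrom-mapPrefix-swapRow J rs up balanced zero = refl
  walkFrom-mapPrefix-swapRow {r} J rs up balanced (suc i) = begin
    isPlusOne (step j₁ j₂ r +ℤ walkFrom (mapPrefix swap J rs) i)
      ≡⟨ cong₂ (λ s t → isPlusOne (s +ℤ t)) up (walkFrom-partialSum (mapPrefix swap J rs) i) ⟩
    isPlusOne (+ 1 +ℤ partialSum (map (step j₁ j₂) (mapPrefix swap J rs)) i)
      ≡⟨ cong (λ zs → isPlusOne (+ 1 +ℤ partialSum zs i)) (map-mapPrefix (step j₁ j₂) step-swapRow J rs) ⟩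
    isPlusOne (+ 1 +ℤ partialSum (mapPrefix -_ J (map (step j₁ j₂) rs)) i)
      ≡⟨ isPlusOne-1+-± (partialSum-negateBalancedPrefix J _
           (trans (sym (walkFrom-partialSum rs J)) balanced) i) ⟩
    isPlusOne (+ 1 +ℤ partialSum (map (step j₁ j₂) rs) i)
      ≡⟨ cong₂ (λ s t → isPlusOne (s +ℤ t)) (sym up) (sym (walkFrom-partialSum rs i)) ⟩
    isPlusOne (step j₁ j₂ r +ℤ walkFrom rs i) ∎
    where open ≡-Reasoning

  -- With i* = J + 1: the walk is at +1 after row 1 and again after row i*.
  record Excursion (M : Mat n) (J : ℕ) : Set where
    field
      first : Vec Bool n
      rest : List (Vec Bool n)
      rows : toList M ≡ first ∷ rest
      first-step : step j₁ j₂ first ≡ + 1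
      balanced : walkFrom rest J ≡ + 0

  excursion : ∀ {M J} → walk M j₁ j₂ 1 ≡ + 1 → walk M j₁ j₂ (suc J) ≡ + 1 → Excursion M J
  excursion {M} w₁ w with toList M in rows
  ... | r ∷ rs = record
    { first = r
    ; rest = rs
    ; rows = rows
    ; first-step = trans (sym (ℤ.+-identityʳ _)) w₁
    ; balanced = ∙-cancelˡ (step j₁ j₂ r) _ (+ 0) (trans w (sym w₁))
    }

  reflectTime-view : ∀ M →
    reflectTime M j₁ j₂ ≡ nothing ⊎ ∃[ J ] reflectTime M j₁ j₂ ≡ just (suc J) × Excursion M J
  reflectTime-view M with reflectTime M j₁ j₂ in eq
  ... | nothing = inj₁ refl
  ... | just zero with () ← proj₂ (reflectTime-just {M = M} eq)
  ... | just (suc J) with reflectTime-just {M = M} eq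
  ...   | w₁ , w = inj₂ (J , refl , excursion w₁ w)

  module _ {M J} (e : Excursion M J) where
    open Excursion e

    toList-swapRows : toList (swapRows (suc J) M) ≡ first ∷ mapPrefix swap J rest
    toList-swapRows = toList-tabulate-segment swap J M rows

    walk-swapRows : ∀ i → isPlusOne (walk (swapRows (suc J) M) j₁ j₂ i) ≡ isPlusOne (walk M j₁ j₂ i)
    walk-swapRows i = begin
      isPlusOne (walkFrom (toList (swapRows (suc J) M)) i)
        ≡⟨ cong (λ rs → isPlusOne (walkFrom rs i)) toList-swapRows ⟩
      isPlusOne (walkFrom (first ∷ mapPrefix swap J rest) i)
        ≡⟨ walkFrom-mapPrefix-swapRow J rest first-step balanced i ⟩
      isPlusOne (walkFrom (first ∷ rest) i)
        ≡⟨ cong (λ rs → isPlusOne (walkFrom rs i)) rows ⟨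
      isPlusOne (walkFrom (toList M) i) ∎
      where open ≡-Reasoning

    colSum-swapRows : ∀ j → colSum (swapRows (suc J) M) j ≡ colSum M j
    colSum-swapRows j = begin
      colSum (swapRows (suc J) M) j                   ≡⟨ colSum-toList (swapRows (suc J) M) j ⟩
      columnCount j (toList (swapRows (suc J) M))     ≡⟨ cong (columnCount j) toList-swapRows ⟩
      entry j first + columnCount j (mapPrefix swap J rest)
        ≡⟨ cong (_+_ (entry j first)) (columnCount-mapPrefix-swapRow J rest balanced j) ⟩
      columnCount j (first ∷ rest)                    ≡⟨ cong (columnCount j) rows ⟨
      columnCount j (toList M)                        ≡⟨ colSum-toList M j ⟨
      colSum M j                                      ∎
      where open ≡-Reasoning

  Ψ-involutive : ∀ M → Ψ j₁ j₂ (Ψ j₁ j₂ M) ≡ M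
  Ψ-involutive M with reflectTime-view M
  ... | inj₁ none = trans (cong (Ψ j₁ j₂) (Ψ-nothing none)) (Ψ-nothing none)
  ... | inj₂ (J , eq , e) = begin
    Ψ j₁ j₂ (Ψ j₁ j₂ M)                  ≡⟨ cong (Ψ j₁ j₂) (Ψ-just eq) ⟩
    Ψ j₁ j₂ (swapRows (suc J) M)         ≡⟨ Ψ-just (trans (reflectTime-cong (walk-swapRows e)) eq) ⟩
    swapRows (suc J) (swapRows (suc J) M) ≡⟨ swapRows-involutive (suc J) M ⟩
    M ∎
    where open ≡-Reasoning

  Ψ-inverse : ∀ {A B} → Ψ j₁ j₂ A ≡ B → Ψ j₁ j₂ B ≡ A
  Ψ-inverse refl = Ψ-involutive _

  inMnd-Ψ : ∀ d M → inMnd d (Ψ j₁ j₂ M) ≡ inMnd d M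
  inMnd-Ψ d M with reflectTime-view M
  ... | inj₁ none = cong (inMnd d) (Ψ-nothing none)
  ... | inj₂ (J , eq , e) =
    trans (cong (inMnd d) (Ψ-just eq))
      (inMnd-cong d {swapRows (suc J) M} {M} (rowSum-swapRows (suc J) M) (colSum-swapRows e))

module _ (d : ℕ) {n : ℕ} (j₁ j₂ : Fin n) where

  Ψ-detailedBalance : ∀ A B →
    indicator (inMnd d A) * indicator (does (Ψ j₁ j₂ A ≟M B))
      ≡ indicator (inMnd d B) * indicator (does (Ψ j₁ j₂ B ≟M A))
  Ψ-detailedBalance A B with Ψ j₁ j₂ A ≟M B
  ... | yes refl
    rewrite dec-true (Ψ j₁ j₂ (Ψ j₁ j₂ A) ≟M A) (Ψ-involutive j₁ j₂ A) | inMnd-Ψ j₁ j₂ d A = refl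
  ... | no ΨA≢B rewrite dec-false (Ψ j₁ j₂ B ≟M A) (ΨA≢B ∘ Ψ-inverse j₁ j₂) =
    trans (ℕ.*-zeroʳ (indicator (inMnd d A))) (sym (ℕ.*-zeroʳ (indicator (inMnd d B))))

module _ {n : ℕ} (d : ℕ) (p : Fin n → Fin n → ℕ) where

  private
    ΣΣ : (Fin n → Fin n → ℕ) → ℕ
    ΣΣ f = sum (map (λ j₁ → sum (map (f j₁) (allFin n))) (allFin n))

    ΣΣ-cong : ∀ {f g} → (∀ j₁ j₂ → f j₁ j₂ ≡ g j₁ j₂) → ΣΣ f ≡ ΣΣ g
    ΣΣ-cong f≗g = sum-map-cong (λ j₁ → sum-map-cong (f≗g j₁) (allFin n)) (allFin n)

    ΣΣ-*ˡ : ∀ a f → a * ΣΣ f ≡ ΣΣ (λ j₁ j₂ → a * f j₁ j₂)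
    ΣΣ-*ˡ a f = trans (sum-map-*ˡ a _ (allFin n)) (sum-map-cong (λ j₁ → sum-map-*ˡ a (f j₁) (allFin n)) (allFin n))

    ΣΣ-exchange : ∀ (g : A → Fin n → Fin n → ℕ) xs →
      sum (map (λ x → ΣΣ (g x)) xs) ≡ ΣΣ (λ j₁ j₂ → sum (map (λ x → g x j₁ j₂) xs))
    ΣΣ-exchange g xs = trans (sum-map-exchange (λ x j₁ → sum (map (g x j₁) (allFin n))) xs (allFin n))
      (sum-map-cong (λ j₁ → sum-map-exchange (λ x → g x j₁) xs (allFin n)) (allFin n))

    transition : Mat n → Mat n → Fin n → Fin n → ℕ
    transition A B j₁ j₂ = p j₁ j₂ * indicator (does (Ψ j₁ j₂ A ≟M B))

  jointMass-symmetric : ∀ A B → jointMass d p A B ≡ jointMass d p B A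
  jointMass-symmetric A B = begin
    indicator (inMnd d A) * ΣΣ (transition A B)
      ≡⟨ ΣΣ-*ˡ (indicator (inMnd d A)) (transition A B) ⟩
    ΣΣ (λ j₁ j₂ → indicator (inMnd d A) * transition A B j₁ j₂)
      ≡⟨ ΣΣ-cong balance ⟩
    ΣΣ (λ j₁ j₂ → indicator (inMnd d B) * transition B A j₁ j₂)
      ≡⟨ ΣΣ-*ˡ (indicator (inMnd d B)) (transition B A) ⟨
    indicator (inMnd d B) * ΣΣ (transition B A) ∎
    where
    open ≡-Reasoning
    balance : ∀ j₁ j₂ →
      indicator (inMnd d A) * transition A B j₁ j₂ ≡ indicator (inMnd d B) * transition B A j₁ j₂
    balance j₁ j₂ = begin
      indicator (inMnd d A) * (p j₁ j₂ * indicator (does (Ψ j₁ j₂ A ≟M B)))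
        ≡⟨ *-left-comm (indicator (inMnd d A)) (p j₁ j₂) _ ⟩
      p j₁ j₂ * (indicator (inMnd d A) * indicator (does (Ψ j₁ j₂ A ≟M B)))
        ≡⟨ cong (p j₁ j₂ *_) (Ψ-detailedBalance d j₁ j₂ A B) ⟩
      p j₁ j₂ * (indicator (inMnd d B) * indicator (does (Ψ j₁ j₂ B ≟M A)))
        ≡⟨ *-left-comm (p j₁ j₂) (indicator (inMnd d B)) _ ⟩
      indicator (inMnd d B) * (p j₁ j₂ * indicator (does (Ψ j₁ j₂ B ≟M A))) ∎

  jointMass-marginal : ∀ B →
    sum (map (λ A → jointMass d p A B) (allMats n)) ≡ indicator (inMnd d B) * totalWeight p
  jointMass-marginal B = begin
    sum (map (λ A → jointMass d p A B) (allMats n))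
      ≡⟨ sum-map-cong (λ A → jointMass-symmetric A B) (allMats n) ⟩
    sum (map (λ A → indicator (inMnd d B) * ΣΣ (transition B A)) (allMats n))
      ≡⟨ sum-map-*ˡ (indicator (inMnd d B)) (λ A → ΣΣ (transition B A)) (allMats n) ⟨
    indicator (inMnd d B) * sum (map (λ A → ΣΣ (transition B A)) (allMats n))
      ≡⟨ cong (indicator (inMnd d B) *_) (trans (ΣΣ-exchange (transition B) (allMats n)) (ΣΣ-cong total)) ⟩
    indicator (inMnd d B) * totalWeight p ∎
    where
    open ≡-Reasoning
    total : ∀ j₁ j₂ → sum (map (λ A → transition B A j₁ j₂) (allMats n)) ≡ p j₁ j₂
    total j₁ j₂ = begin
      sum (map (λ A → p j₁ j₂ * indicator (does (Ψ j₁ j₂ B ≟M A))) (allMats n))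
        ≡⟨ sum-map-*ˡ (p j₁ j₂) _ (allMats n) ⟨
      p j₁ j₂ * multiplicity _≟M_ (Ψ j₁ j₂ B) (allMats n)
        ≡⟨ cong (p j₁ j₂ *_) (allMats-multiplicity n (Ψ j₁ j₂ B)) ⟩
      p j₁ j₂ * 1
        ≡⟨ ℕ.*-identityʳ (p j₁ j₂) ⟩
      p j₁ j₂ ∎

lemma3p4 : (n d : ℕ) → 1 ≤ n → 1 ≤ d → d ≤ n → (p : Fin n → Fin n → ℕ) →
    ((A B : Mat n) → jointMass d p A B ≡ jointMass d p B A) ×
    ((B : Mat n) → sum (map (λ A → jointMass d p A B) (allMats n)) ≡ indicator (inMnd d B) * totalWeight p)
lemma3p4 n d _ _ _ p = jointMass-symmetric d p , jointMass-marginal d p
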